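{- Let $s\geq 5$ be an integer and $\tau\in[0,1/s)$. For every prime $p$ sufficiently large in terms of $s$ and $\tau$, there exists a subset $A_p\subseteq(\mathbb{Z}/p)^{(2)}$ with $|A_p|\geq \tau\,|(\mathbb{Z}/p)^{(2)}|$ such that the $s$-fold sumset $sA_p=\{x_1+\dots+x_s: x_i\in A_p\}$ is not equal to $\mathbb{Z}/p$.
   Context: $(\mathbb{Z}/p)^{(2)}$ denotes the set of squares in $\mathbb{Z}/p$ (including $0$).
   Formalization: The parameter τ ranges over the rationals in $[0,1/s)$. -}

module Defs where

open import Data.Nat using (ℕ; NonZero; _*_; _%_)
open import Data.Nat.Properties using (_≟_)
open import Data.Fin using (Fin; toℕ)
open import Data.Fin.Properties using (any?)
open import Data.Fin.Subset using (Subset; inside; outside; _∈_)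
open import Data.Vec using (Vec; tabulate; lookup; foldr)
open import Data.Product using (Σ; ∃; _×_)
open import Data.Bool using (if_then_else_)
open import Relation.Nullary using (does)
open import Relation.Binary.PropositionalEquality using (_≡_)

-- ℤ/p is represented by Fin p (residues 0 … p-1), arithmetic via _%_ p.

-- x is a square in ℤ/p (0 included): x ≡ y² (mod p) for some y.
IsSquareMod : (p : ℕ) → .{{_ : NonZero p}} → Fin p → Set
IsSquareMod p x = ∃ λ (y : Fin p) → (toℕ y * toℕ y) % p ≡ toℕ x

Squares : (p : ℕ) → .{{_ : NonZero p}} → Subset p
Squares p = tabulate {n = p} λ x →
  if does (any? {n = p} {P = λ y → (toℕ y * toℕ y) % p ≡ toℕ x}
                (λ y → (toℕ y * toℕ y) % p ≟ toℕ x))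
  then inside else outside

InSumset : (p : ℕ) → .{{_ : NonZero p}} → (s : ℕ) → Subset p → Fin p → Set
InSumset p s A z =
  Σ (Vec (Fin p) s) λ xs →
    ((i : Data.Fin.Fin s) → lookup xs i ∈ A) ×
    (foldr (λ _ → ℕ) (λ x acc → toℕ x Data.Nat.+ acc) 0 xs) % p ≡ toℕ z

{-# OPTIONS --safe #-}
-- Cover ℤ/p by the p cyclic translates of the interval {0, …, ℓ - 1} of residues. Every residue lies in
-- exactly ℓ of them, so by averaging some translate I contains at least a fraction ℓ/p of the squares;
-- take A to be the squares in I. An s-fold sum of elements of a translate of {0, …, ℓ - 1} lies in the
-- corresponding translate of {0, …, s(ℓ - 1)}, which misses a residue as soon as sℓ < p. For τ = a/D the
-- choice ℓ = ⌊ap/D⌋ + 1 gives ℓ/p ≥ τ, and sℓ < p once p > sD, since as < D.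

module Submission where

open import Defs

module ScaledRationals where

  open import Data.Integer.Base as ℤ using (+_; +≤+)
  import Data.Integer.Properties as ℤ
  open import Data.Nat.Base using (suc; _*_; _≤_; _<_)
  open import Data.Nat.Coprimality using (Coprime)
  open import Data.Nat.Properties using (*-comm; *-identityʳ; module ≤-Reasoning)
  open import Data.Rational.Base as ℚ using (mkℚ; 1ℚ; _/_; toℚᵘ)
  open import Data.Rational.Properties
    using (toℚᵘ-homo-*; toℚᵘ-fromℚᵘ; toℚᵘ-mono-<; toℚᵘ-cancel-≤)
  open import Data.Rational.Unnormalised.Base as ℚᵘ using (mkℚᵘ; *≤*; *<*)
  import Data.Rational.Unnormalised.Properties as ℚᵘ
  open import Relation.Binary.PropositionalEquality

  toℚᵘ-*-[m/1] : ∀ τ m → toℚᵘ (τ ℚ.* (+ m / 1)) ℚᵘ.≃ toℚᵘ τ ℚᵘ.* mkℚᵘ (+ m) 0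
  toℚᵘ-*-[m/1] τ m = ℚᵘ.≃-trans (toℚᵘ-homo-* τ (+ m / 1))
                                 (ℚᵘ.*-congˡ {toℚᵘ τ} (toℚᵘ-fromℚᵘ (mkℚᵘ (+ m) 0)))

  +a*+m*+1≡+[a*m] : ∀ a m → (+ a ℤ.* + m) ℤ.* + 1 ≡ + (a * m)
  +a*+m*+1≡+[a*m] a m = trans (ℤ.*-identityʳ _) (sym (ℤ.pos-* a m))

  [a/D]*m<1⇒a*m<D : ∀ {a d m} .{c : Coprime a (suc d)} →
                    mkℚ (+ a) d c ℚ.* (+ m / 1) ℚ.< 1ℚ → a * m < suc d
  [a/D]*m<1⇒a*m<D {a} {d} {m} τm<1 with ℚᵘ.<-respˡ-≃ (toℚᵘ-*-[m/1] _ m) (toℚᵘ-mono-< τm<1)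
  ... | *<* am<D = begin-strict
    a * m          <⟨ ℤ.drop‿+<+ (subst₂ ℤ._<_ (+a*+m*+1≡+[a*m] a m) (ℤ.*-identityˡ _) am<D) ⟩
    suc d * 1      ≡⟨ *-identityʳ (suc d) ⟩
    suc d          ∎
    where open ≤-Reasoning

  a*m≤D*n⇒[a/D]*m≤n : ∀ {a d m n} .{c : Coprime a (suc d)} →
                      a * m ≤ suc d * n → mkℚ (+ a) d c ℚ.* (+ m / 1) ℚ.≤ + n / 1
  a*m≤D*n⇒[a/D]*m≤n {a} {d} {m} {n} am≤Dn =
    toℚᵘ-cancel-≤ (ℚᵘ.≤-respˡ-≃ (ℚᵘ.≃-sym (toℚᵘ-*-[m/1] _ m))
                  (ℚᵘ.≤-respʳ-≃ (ℚᵘ.≃-sym (toℚᵘ-fromℚᵘ (mkℚᵘ (+ n) 0)))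
                  (*≤* (subst₂ ℤ._≤_ (sym (+a*+m*+1≡+[a*m] a m)) +[D*n]≡+n*+[D*1] (+≤+ am≤Dn)))))
    where
    +[D*n]≡+n*+[D*1] : + (suc d * n) ≡ + n ℤ.* + (suc d * 1)
    +[D*n]≡+n*+[D*1] = begin
      + (suc d * n)        ≡⟨ cong +_ (*-comm (suc d) n) ⟩
      + (n * suc d)        ≡⟨ cong (λ D → + (n * D)) (*-identityʳ (suc d)) ⟨
      + (n * (suc d * 1))  ≡⟨ ℤ.pos-* n (suc d * 1) ⟩
      + n ℤ.* + (suc d * 1) ∎
      where open ≡-Reasoning

module Windows where

  open import Data.Bool.Base using (Bool; true; false; _∧_; T)
  open import Data.Fin.Base using (Fin; zero; suc; toℕ; fromℕ<)
  open import Data.Fin.Properties using (toℕ<n; toℕ-fromℕ; toℕ-fromℕ<; toℕ-inject₁)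
  open import Data.Fin.Subset using (Subset; _∈_; _⊆_; _∩_; ∣_∣)
  open import Data.Fin.Subset.Properties using (p∩q⊆p; p∩q⊆q)
  open import Data.Nat.Base
  open import Data.Nat.DivMod
  open import Data.Nat.Properties
  open import Algebra.Properties.Semiring.Sum +-*-semiring
    using (sum; sum-syntax; sum-cong-≗; sum-init-last; sum-replicate-zero; ∑-comm; *-distribˡ-sum)
  open import Data.Nat.Solver using (module +-*-Solver)
  open import Data.Product using (Σ; ∃; _×_; _,_)
  open import Data.Sum.Base using (inj₁; inj₂)
  open import Data.Vec.Base using (Vec; []; _∷_; lookup; tabulate; foldr)
  open import Data.Vec.Functional using (Vector)
  open import Data.Vec.Properties using (lookup∘tabulate; lookup-zipWith; []=⇒lookup)
  open import Data.Unit.Base using (tt)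
  open import Function.Base using (_∘_)
  open import Relation.Binary.PropositionalEquality
  open import Relation.Nullary.Negation using (¬_)

  open +-*-Solver using (solve; _:+_; _:*_; _:=_; con)

  𝟙 : Bool → ℕ
  𝟙 true = 1
  𝟙 false = 0

  𝟙-∧ : ∀ u v → 𝟙 (u ∧ v) ≡ 𝟙 u * 𝟙 v
  𝟙-∧ true v = sym (+-identityʳ (𝟙 v))
  𝟙-∧ false v = refl

  ∣p∣≡∑𝟙 : ∀ {n} (p : Subset n) → ∣ p ∣ ≡ ∑[ i < n ] 𝟙 (lookup p i)
  ∣p∣≡∑𝟙 [] = refl
  ∣p∣≡∑𝟙 (true ∷ p) = cong suc (∣p∣≡∑𝟙 p)
  ∣p∣≡∑𝟙 (false ∷ p) = ∣p∣≡∑𝟙 p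

  ∣p∩q∣≡∑𝟙*𝟙 : ∀ {n} (p q : Subset n) →
               ∣ p ∩ q ∣ ≡ ∑[ i < n ] (𝟙 (lookup p i) * 𝟙 (lookup q i))
  ∣p∩q∣≡∑𝟙*𝟙 p q = trans (∣p∣≡∑𝟙 (p ∩ q)) (sum-cong-≗ λ i →
    trans (cong 𝟙 (lookup-zipWith _∧_ i p q)) (𝟙-∧ (lookup p i) (lookup q i)))

  ∑-<ᵇ : ∀ n ℓ → ∑[ i < n ] 𝟙 (toℕ i <ᵇ ℓ) ≡ n ⊓ ℓ
  ∑-<ᵇ zero ℓ = refl
  ∑-<ᵇ (suc n) zero = sum-replicate-zero n
  ∑-<ᵇ (suc n) (suc ℓ) = cong suc (∑-<ᵇ n ℓ)

  ∑-head≡∑-last : ∀ n (f : ℕ → ℕ) →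
                  f 0 + ∑[ i < n ] f (suc (toℕ i)) ≡ ∑[ i < n ] f (toℕ i) + f n
  ∑-head≡∑-last n f = trans (sum-init-last {n} (f ∘ toℕ)) (cong₂ _+_
    (sum-cong-≗ {n} (cong f ∘ toℕ-inject₁)) (cong f (toℕ-fromℕ n)))

  ∑-periodic-shift : ∀ {p} (h : ℕ → ℕ) → (∀ n → h (n + p) ≡ h n) →
                     ∀ k → ∑[ i < p ] h (k + toℕ i) ≡ ∑[ i < p ] h (toℕ i)
  ∑-periodic-shift h periodic zero = refl
  ∑-periodic-shift {p} h periodic (suc k) = trans shift-by-one (∑-periodic-shift h periodic k)
    where
    open ≡-Reasoning
    g : ℕ → ℕ
    g j = h (k + j)
    g0≡gp : g 0 ≡ g p
    g0≡gp = trans (cong h (+-identityʳ k)) (sym (periodic k))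
    shift-by-one : ∑[ i < p ] h (suc k + toℕ i) ≡ ∑[ i < p ] g (toℕ i)
    shift-by-one = +-cancelˡ-≡ (g 0) _ _ (begin
      g 0 + ∑[ i < p ] h (suc (k + toℕ i))
        ≡⟨ cong (g 0 +_) (sum-cong-≗ {p} λ i → cong h (sym (+-suc k (toℕ i)))) ⟩
      g 0 + ∑[ i < p ] g (suc (toℕ i))
        ≡⟨ ∑-head≡∑-last p g ⟩
      ∑[ i < p ] g (toℕ i) + g p
        ≡⟨ cong₂ _+_ refl (sym g0≡gp) ⟩
      ∑[ i < p ] g (toℕ i) + g 0
        ≡⟨ +-comm _ (g 0) ⟩
      g 0 + ∑[ i < p ] g (toℕ i)
        ∎)

  ∃-≥-mean : ∀ {n} .⦃ _ : NonZero n ⦄ (f : Vector ℕ n) → ∃ λ i → sum f ≤ n * f i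
  ∃-≥-mean {suc zero} f = zero , ≤-refl
  ∃-≥-mean {suc (suc n)} f with ∃-≥-mean (f ∘ suc)
  ... | i , ∑tail≤ with ≤-total (f zero) (f (suc i))
  ...   | inj₁ f0≤fi = suc i , +-mono-≤ f0≤fi ∑tail≤
  ...   | inj₂ fi≤f0 = zero , +-monoʳ-≤ (f zero) (≤-trans ∑tail≤ (*-monoʳ-≤ (suc n) fi≤f0))

  %-absorbˡ : ∀ m n p .⦃ _ : NonZero p ⦄ → (m % p + n) % p ≡ (m + n) % p
  %-absorbˡ m n p = begin
    (m % p + n) % p           ≡⟨ %-distribˡ-+ (m % p) n p ⟩
    (m % p % p + n % p) % p   ≡⟨ cong (λ r → (r + n % p) % p) (m%n%n≡m%n m p) ⟩
    (m % p + n % p) % p       ≡⟨ %-distribˡ-+ m n p ⟨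
    (m + n) % p               ∎
    where open ≡-Reasoning

  %-absorbʳ : ∀ m n p .⦃ _ : NonZero p ⦄ → (m + n % p) % p ≡ (m + n) % p
  %-absorbʳ m n p = begin
    (m + n % p) % p ≡⟨ cong (_% p) (+-comm m (n % p)) ⟩
    (n % p + m) % p ≡⟨ %-absorbˡ n m p ⟩
    (n + m) % p     ≡⟨ cong (_% p) (+-comm n m) ⟩
    (m + n) % p     ∎
    where open ≡-Reasoning

  ∃-[z+c]%p≡m : ∀ p .⦃ _ : NonZero p ⦄ c {m} → m < p → ∃ λ (z : Fin p) → (toℕ z + c) % p ≡ m
  ∃-[z+c]%p≡m (suc q) c {m} m<p = fromℕ< (m%n<n r p) , (begin
    (toℕ (fromℕ< (m%n<n r p)) + c) % p
      ≡⟨ cong (λ t → (t + c) % p) (toℕ-fromℕ< (m%n<n r p)) ⟩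
    (r % p + c) % p
      ≡⟨ %-absorbˡ r c p ⟩
    (m + q * c + c) % p
      ≡⟨ cong (_% p) (solve 3 (λ m q c → m :+ q :* c :+ c := m :+ c :* (con 1 :+ q)) refl m q c) ⟩
    (m + c * p) % p
      ≡⟨ [m+kn]%n≡m%n m c p ⟩
    m % p
      ≡⟨ m<n⇒m%n≡m m<p ⟩
    m ∎)
    where
    open ≡-Reasoning
    p = suc q
    r = m + q * c

  Window : (p : ℕ) .⦃ _ : NonZero p ⦄ → ℕ → Fin p → Subset p
  Window p ℓ b = tabulate λ x → (toℕ x + toℕ b) % p <ᵇ ℓ

  module _ {p : ℕ} .⦃ _ : NonZero p ⦄ {ℓ : ℕ} where

    ∈Window⇒ : ∀ {b x} → x ∈ Window p ℓ b → (toℕ x + toℕ b) % p < ℓ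
    ∈Window⇒ {b} {x} x∈W = <ᵇ⇒< _ ℓ (subst T (sym x<ᵇℓ) tt)
      where
      x<ᵇℓ : ((toℕ x + toℕ b) % p <ᵇ ℓ) ≡ true
      x<ᵇℓ = trans (sym (lookup∘tabulate _ x)) ([]=⇒lookup x∈W)

    ∑-Window-count : ℓ ≤ p → ∀ x → ∑[ b < p ] 𝟙 (lookup (Window p ℓ b) x) ≡ ℓ
    ∑-Window-count ℓ≤p x = begin
      ∑[ b < p ] 𝟙 (lookup (Window p ℓ b) x)
        ≡⟨ sum-cong-≗ {p} (λ b → cong 𝟙 (lookup∘tabulate _ x)) ⟩
      ∑[ b < p ] h (toℕ x + toℕ b)
        ≡⟨ ∑-periodic-shift h (λ n → cong (λ r → 𝟙 (r <ᵇ ℓ)) ([m+n]%n≡m%n n p)) (toℕ x) ⟩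
      ∑[ b < p ] h (toℕ b)
        ≡⟨ sum-cong-≗ {p} (λ b → cong (λ r → 𝟙 (r <ᵇ ℓ)) (m<n⇒m%n≡m (toℕ<n b))) ⟩
      ∑[ b < p ] 𝟙 (toℕ b <ᵇ ℓ)
        ≡⟨ ∑-<ᵇ p ℓ ⟩
      p ⊓ ℓ
        ≡⟨ m≥n⇒m⊓n≡n ℓ≤p ⟩
      ℓ ∎
      where
      open ≡-Reasoning
      h : ℕ → ℕ
      h n = 𝟙 (n % p <ᵇ ℓ)

    ∑∣S∩Window∣ : ℓ ≤ p → (S : Subset p) → ∑[ b < p ] ∣ S ∩ Window p ℓ b ∣ ≡ ℓ * ∣ S ∣
    ∑∣S∩Window∣ ℓ≤p S = begin
      ∑[ b < p ] ∣ S ∩ Window p ℓ b ∣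
        ≡⟨ sum-cong-≗ {p} (λ b → ∣p∩q∣≡∑𝟙*𝟙 S (Window p ℓ b)) ⟩
      ∑[ b < p ] ∑[ x < p ] (𝟙S x * 𝟙W b x)
        ≡⟨ ∑-comm (λ b x → 𝟙S x * 𝟙W b x) ⟩
      ∑[ x < p ] ∑[ b < p ] (𝟙S x * 𝟙W b x)
        ≡⟨ sum-cong-≗ {p} (λ x → sym (*-distribˡ-sum (𝟙S x) (λ b → 𝟙W b x))) ⟩
      ∑[ x < p ] (𝟙S x * ∑[ b < p ] 𝟙W b x)
        ≡⟨ sum-cong-≗ {p} (λ x → cong (𝟙S x *_) (∑-Window-count ℓ≤p x)) ⟩
      ∑[ x < p ] (𝟙S x * ℓ)
        ≡⟨ sum-cong-≗ {p} (λ x → *-comm (𝟙S x) ℓ) ⟩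
      ∑[ x < p ] (ℓ * 𝟙S x)
        ≡⟨ *-distribˡ-sum ℓ 𝟙S ⟨
      ℓ * ∑[ x < p ] 𝟙S x
        ≡⟨ cong (ℓ *_) (∣p∣≡∑𝟙 S) ⟨
      ℓ * ∣ S ∣ ∎
      where
      open ≡-Reasoning
      𝟙S : Fin p → ℕ
      𝟙S x = 𝟙 (lookup S x)
      𝟙W : Fin p → Fin p → ℕ
      𝟙W b x = 𝟙 (lookup (Window p ℓ b) x)

    ∃-dense-Window : ℓ ≤ p → (S : Subset p) →
                     ∃ λ b → ℓ * ∣ S ∣ ≤ p * ∣ S ∩ Window p ℓ b ∣
    ∃-dense-Window ℓ≤p S with ∃-≥-mean (λ b → ∣ S ∩ Window p ℓ b ∣)
    ... | b , ∑≤ = b , subst (_≤ p * ∣ S ∩ Window p ℓ b ∣) (∑∣S∩Window∣ ℓ≤p S) ∑≤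

  module _ {p : ℕ} .⦃ _ : NonZero p ⦄ where

    ∑ᵥ : ∀ {s} → Vec (Fin p) s → ℕ
    ∑ᵥ = foldr (λ _ → ℕ) (λ x acc → toℕ x + acc) 0

    ∑ᵥ-shifted : ∀ {s} → ℕ → Vec (Fin p) s → ℕ
    ∑ᵥ-shifted b = foldr (λ _ → ℕ) (λ x acc → (toℕ x + b) % p + acc) 0

    ∑ᵥ-shifted-≡ : ∀ {s} b (xs : Vec (Fin p) s) → ∑ᵥ-shifted b xs % p ≡ (∑ᵥ xs + s * b) % p
    ∑ᵥ-shifted-≡ b [] = refl
    ∑ᵥ-shifted-≡ {suc s} b (x ∷ xs) = begin
      ((toℕ x + b) % p + ∑ᵥ-shifted b xs) % p
        ≡⟨ %-absorbˡ (toℕ x + b) _ p ⟩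
      (toℕ x + b + ∑ᵥ-shifted b xs) % p
        ≡⟨ %-absorbʳ (toℕ x + b) _ p ⟨
      (toℕ x + b + ∑ᵥ-shifted b xs % p) % p
        ≡⟨ cong (λ r → (toℕ x + b + r) % p) (∑ᵥ-shifted-≡ b xs) ⟩
      (toℕ x + b + (∑ᵥ xs + s * b) % p) % p
        ≡⟨ %-absorbʳ (toℕ x + b) _ p ⟩
      (toℕ x + b + (∑ᵥ xs + s * b)) % p
        ≡⟨ cong (_% p) (solve 4 (λ x b t sb → x :+ b :+ (t :+ sb) := x :+ t :+ (b :+ sb))
                               refl (toℕ x) b (∑ᵥ xs) (s * b)) ⟩
      (toℕ x + ∑ᵥ xs + (b + s * b)) % p ∎
      where open ≡-Reasoning

    ∑ᵥ-shifted-bound : ∀ {s ℓ} b (xs : Vec (Fin p) s) → (∀ i → (toℕ (lookup xs i) + b) % p < ℓ) →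
                       ∑ᵥ-shifted b xs + s ≤ s * ℓ
    ∑ᵥ-shifted-bound b [] _ = z≤n
    ∑ᵥ-shifted-bound {suc s} b (x ∷ xs) below = begin
      y + Y + suc s   ≡⟨ solve 3 (λ y Y s → y :+ Y :+ (con 1 :+ s) := con 1 :+ y :+ (Y :+ s)) refl y Y s ⟩
      suc y + (Y + s) ≤⟨ +-mono-≤ (below zero) (∑ᵥ-shifted-bound b xs (below ∘ suc)) ⟩
      _ + s * _       ∎
      where
      open ≤-Reasoning
      y = (toℕ x + b) % p
      Y = ∑ᵥ-shifted b xs

    ⊆Window⇒∉Sumset : ∀ {s ℓ b z} {A : Subset p} → 1 ≤ s → s * ℓ < p → A ⊆ Window p ℓ b →
                      (toℕ z + s * toℕ b) % p ≡ s * ℓ → ¬ InSumset p s A z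
    ⊆Window⇒∉Sumset {s} {ℓ} {b} {z} 1≤s sℓ<p A⊆W target (xs , xs∈A , ∑xs≡z) =
      <-irrefl Y≡sℓ Y<sℓ
      where
      open ≡-Reasoning
      Y = ∑ᵥ-shifted (toℕ b) xs
      Y<sℓ : Y < s * ℓ
      Y<sℓ = <-≤-trans (m<m+n Y 1≤s)
                       (∑ᵥ-shifted-bound (toℕ b) xs (λ i → ∈Window⇒ (A⊆W (xs∈A i))))
      Y≡sℓ : Y ≡ s * ℓ
      Y≡sℓ = begin
        Y                            ≡⟨ m<n⇒m%n≡m (<-trans Y<sℓ sℓ<p) ⟨
        Y % p                        ≡⟨ ∑ᵥ-shifted-≡ (toℕ b) xs ⟩
        (∑ᵥ xs + s * toℕ b) % p      ≡⟨ %-absorbˡ (∑ᵥ xs) _ p ⟨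
        (∑ᵥ xs % p + s * toℕ b) % p  ≡⟨ cong (λ r → (r + s * toℕ b) % p) ∑xs≡z ⟩
        (toℕ z + s * toℕ b) % p      ≡⟨ target ⟩
        s * ℓ                        ∎

  ∃-window-length : ∀ a d s p → a * s < suc d → s * suc d < p →
                    ∃ λ ℓ → a * p ≤ suc d * ℓ × s * ℓ < p
  ∃-window-length a d s p as<D sD<p = k + 1 , ap≤Dℓ , sℓ<p
    where
    D = suc d
    k = a * p / D
    ap≤Dℓ : a * p ≤ D * (k + 1)
    ap≤Dℓ = begin
      a * p                ≡⟨ m≡m%n+[m/n]*n (a * p) D ⟩
      a * p % D + k * D    ≤⟨ +-monoˡ-≤ (k * D) (<⇒≤ (m%n<n (a * p) D)) ⟩
      D + k * D            ≡⟨ solve 2 (λ D k → D :+ k :* D := D :* (k :+ con 1)) refl D k ⟩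
      D * (k + 1)          ∎
      where open ≤-Reasoning
    sℓ<p : s * (k + 1) < p
    sℓ<p = *-cancelˡ-< D (s * (k + 1)) p (begin-strict
      D * (s * (k + 1))    ≡⟨ solve 3 (λ D s k → D :* (s :* (k :+ con 1)) := s :* (k :* D) :+ s :* D) refl D s k ⟩
      s * (k * D) + s * D  ≤⟨ +-monoˡ-≤ (s * D) (*-monoʳ-≤ s (m/n*n≤m (a * p) D)) ⟩
      s * (a * p) + s * D  <⟨ +-monoʳ-< (s * (a * p)) sD<p ⟩
      s * (a * p) + p      ≡⟨ solve 3 (λ s a p → s :* (a :* p) :+ p := (con 1 :+ a :* s) :* p) refl s a p ⟩
      suc (a * s) * p      ≤⟨ *-monoˡ-≤ p as<D ⟩
      D * p                ∎)
      where open ≤-Reasoning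

  *-cross-≤-trans : ∀ {a D ℓ x y} p .⦃ _ : NonZero p ⦄ →
                    a * p ≤ D * ℓ → ℓ * x ≤ p * y → a * x ≤ D * y
  *-cross-≤-trans {a} {D} {ℓ} {x} {y} p ap≤Dℓ ℓx≤py = *-cancelˡ-≤ p (begin
    p * (a * x)  ≡⟨ solve 3 (λ p a x → p :* (a :* x) := (a :* p) :* x) refl p a x ⟩
    a * p * x    ≤⟨ *-monoˡ-≤ x ap≤Dℓ ⟩
    D * ℓ * x    ≡⟨ *-assoc D ℓ x ⟩
    D * (ℓ * x)  ≤⟨ *-monoʳ-≤ D ℓx≤py ⟩
    D * (p * y)  ≡⟨ solve 3 (λ D p y → D :* (p :* y) := p :* (D :* y)) refl D p y ⟩
    p * (D * y)  ∎)
    where open ≤-Reasoning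

  ∃-dense-subset-with-incomplete-sumset :
    ∀ {s} a d p .⦃ _ : NonZero p ⦄ (S : Subset p) → 1 ≤ s → a * s < suc d → s * suc d < p →
    Σ (Subset p) λ A → A ⊆ S × a * ∣ S ∣ ≤ suc d * ∣ A ∣ × ∃ λ z → ¬ InSumset p s A z
  ∃-dense-subset-with-incomplete-sumset {s} a d p S 1≤s as<D sD<p =
    let ℓ , ap≤Dℓ , sℓ<p = ∃-window-length a d s p as<D sD<p
        ℓ≤p = ≤-trans (m≤n*m ℓ s ⦃ >-nonZero 1≤s ⦄) (<⇒≤ sℓ<p)
        b , dense = ∃-dense-Window ℓ≤p S
        z , target = ∃-[z+c]%p≡m p (s * toℕ b) sℓ<p
    in S ∩ Window p ℓ b , p∩q⊆p S _ , *-cross-≤-trans {a} {suc d} {ℓ} p ap≤Dℓ dense , z ,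
       ⊆Window⇒∉Sumset 1≤s sℓ<p (p∩q⊆q S _) target

open ScaledRationals
open Windows

open import Data.Nat using (ℕ; NonZero; _≤_)
open import Data.Nat.Primality using (Prime)
open import Data.Integer using (+_)
open import Data.Rational using (ℚ; _/_; 0ℚ; 1ℚ; _*_; _<_) renaming (_≤_ to _≤ℚ_)
open import Data.Fin using (Fin)
open import Data.Fin.Subset using (Subset; _⊆_; ∣_∣)
open import Data.Product using (Σ; ∃; _×_)
open import Relation.Nullary using (¬_)

open import Data.Integer using (-[1+_])
open import Data.Nat as ℕ using (suc; s≤s; z≤n)
open import Data.Nat.Properties using (≤-trans)
open import Data.Product using (_,_)
open import Data.Rational using (mkℚ; *≤*)

theorem1p2 : (s : ℕ) → 5 ≤ s → (τ : ℚ) → 0ℚ ≤ℚ τ → τ * ((+ s) / 1) < 1ℚ →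
    ∃ λ (P₀ : ℕ) → (p : ℕ) → .{{_ : NonZero p}} → P₀ ≤ p → Prime p →
      Σ (Subset p) λ A →
        (A ⊆ Squares p) ×
        (τ * ((+ ∣ Squares p ∣) / 1) ≤ℚ (+ ∣ A ∣) / 1) ×
        (∃ λ (z : Fin p) → ¬ InSumset p s A z)
theorem1p2 _ _ (mkℚ -[1+ _ ] _ _) (*≤* ()) _
theorem1p2 s 5≤s (mkℚ (+ a) d _) _ τs<1 = suc (s ℕ.* suc d) , λ where
  p sD<p _ →
    let A , A⊆S , dense , z∉sA =
          ∃-dense-subset-with-incomplete-sumset a d p (Squares p)
            (≤-trans (s≤s z≤n) 5≤s) ([a/D]*m<1⇒a*m<D {a} {d} {s} τs<1) sD<p
    in A , A⊆S , a*m≤D*n⇒[a/D]*m≤n {a} {d} {∣ Squares p ∣} {∣ A ∣} dense , z∉sA
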